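{- Let $\mathcal{A}^*$ be a deterministic external memory algorithm for the permutation problem (defined in the context) that makes at most $t$ I/Os on every input. Then the number of distinct I/O-graphs that can result from executing $\mathcal{A}^*$ on inputs of the permutation problem is at most $$\left(t+n(w+\lg n)/b+nw/b+1\right)^{t+1}.$$
   Context: External memory model: internal memory of $m$ bits, unbounded disk partitioned into blocks of $b$ bits; an I/O reads or writes one block; cost is number of I/Os; computation in memory is free and unrestricted. Permutation problem: input is a permutation $\pi$ of $\{1,\dots,n\}$ and bit strings $d_1,\dots,d_n\in\{0,1\}^w$, with $w\ge\lg n$, given as an array $A$ whose $i$-th entry stores $(\pi(i),d_i)$ ($\pi(i)$ encoded in $\lceil\lg n\rceil$ bits), packed $b/(w+\lg n)$ entries per block (assume $(w+\lg n)$ divides $b$), so $A$ occupies $n(w+\lg n)/b$ blocks. There is an initially empty output array $C$ of $n$ words of $w$ bits, packed $b/w$ per block ($nw/b$ blocks). The goal is to store $d_i$ in $C[\pi(i)]$ for all $i$. I/O-graph of a deterministic algorithm on an input: start with one block node per disk block of $A$, one block node per disk block of $C$, and one memory node; all nodes are live, and block nodes get distinct integer labels. Process the I/Os of the execution in order. If the I/O is the first access to a disk block not belonging to $A$ or $C$, create a new live block node with a fresh label and add a directed edge from the live memory node to it. Otherwise let $v$ be the live block node of that disk block; add an edge from $v$ to the live memory node, mark $v$ dead, create a new live block node $v'$ with the same label as $v$, and add an edge from the live memory node to $v'$. In addition, after every $m/b$ I/Os, mark the memory node dead, create a new live memory node, and add a directed edge from the old memory node to the new one. -}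

module Defs where

open import Data.Bool using (Bool; true; false; if_then_else_; _∧_)
open import Data.Nat using (ℕ; zero; suc; _+_; _*_; _∸_; _≤ᵇ_; _<ᵇ_; _≡ᵇ_; _/_; _%_; NonZero)
open import Data.Nat.Logarithm using (⌈log₂_⌉)
open import Data.Fin using (Fin; toℕ)
open import Data.Fin.Permutation using (Permutation′; _⟨$⟩ʳ_)
open import Data.Vec using (Vec; []; _∷_; tabulate; concat; _++_; toList; replicate)
open import Data.List using (List; []; _∷_) renaming (_++_ to _++ˡ_)
open import Data.Maybe using (Maybe; just; nothing)
open import Data.Product using (_×_; _,_)

bitAt : List Bool → ℕ → Bool
bitAt []       _       = false
bitAt (x ∷ xs) zero    = x
bitAt (x ∷ xs) (suc p) = bitAt xs p

bitsOf : (k : ℕ) → ℕ → Vec Bool k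
bitsOf zero    x = []
bitsOf (suc k) x = (x % 2 ≡ᵇ 1) ∷ bitsOf k (x / 2)

Disk : Set
Disk = ℕ → Bool

readBlock : (b : ℕ) → Disk → ℕ → Vec Bool b
readBlock b D j = tabulate (λ r → D (j * b + toℕ r))

writeBlock : (b : ℕ) → Disk → ℕ → Vec Bool b → Disk
writeBlock b D j blk p =
  if (j * b ≤ᵇ p) ∧ (p <ᵇ j * b + b) then bitAt (toList blk) (p ∸ j * b) else D p

-- A occupies the first n(w+lg n) bits of the disk (blocks 0 .. n(w+lg n)/b - 1);
-- entry i (0-based) is the ⌈lg n⌉-bit encoding of π(i) followed by d_i.
-- C occupies the next n w bits (blocks n(w+lg n)/b .. n(w+lg n)/b + nw/b - 1),
-- initially all zero; C[j] is the w-bit word starting at bit n(w+lg n) + j w.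
-- Elements of {1..n} are represented by Fin n (value k ↦ k-1).

lg : ℕ → ℕ
lg n = ⌈log₂ n ⌉

inputBits : (n w : ℕ) → Permutation′ n → (Fin n → Vec Bool w) → Vec Bool (n * (lg n + w))
inputBits n w π d = concat (tabulate (λ i → bitsOf (lg n) (toℕ (π ⟨$⟩ʳ i)) ++ d i))

initialDisk : (n w : ℕ) → Permutation′ n → (Fin n → Vec Bool w) → Disk
initialDisk n w π d = bitAt (toList (inputBits n w π d))

-- Computation in memory is free, so an algorithm is a function
-- from the current memory contents to its next I/O (or halting):
--   read j f   : read disk block j; new memory = f (contents of block j)
--   write j x M : write block x to disk block j; new memory = M

data Op (m b : ℕ) : Set where
  halt  : Op m b
  read  : ℕ → (Vec Bool b → Vec Bool m) → Op m b
  write : ℕ → Vec Bool b → Vec Bool m → Op m b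

Algorithm : ℕ → ℕ → Set
Algorithm m b = Vec Bool m → Op m b

exec : ∀ {m b} → Algorithm m b → ℕ → Vec Bool m → Disk → List ℕ × Disk × Bool
exec {m} {b} 𝒜 fuel M D with 𝒜 M
... | halt = [] , D , true
exec {m} {b} 𝒜 zero M D | read j f = [] , D , false
exec {m} {b} 𝒜 (suc k) M D | read j f with exec 𝒜 k (f (readBlock b D j)) D
... | as , D' , h = j ∷ as , D' , h
exec {m} {b} 𝒜 zero M D | write j x M' = [] , D , false
exec {m} {b} 𝒜 (suc k) M D | write j x M' with exec 𝒜 k M' (writeBlock b D j x)
... | as , D' , h = j ∷ as , D' , h

run : (n w : ℕ) {m b : ℕ} → Algorithm m b → ℕ → Permutation′ n → (Fin n → Vec Bool w)
    → List ℕ × Disk × Bool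
run n w {m} 𝒜 fuel π d = exec 𝒜 fuel (replicate m false) (initialDisk n w π d)

accesses : ∀ {A B : Set} → List ℕ × A × B → List ℕ
accesses (as , _ , _) = as

finalDisk : ∀ {A B : Set} → A × Disk × B → Disk
finalDisk (_ , D , _) = D

halted : ∀ {A B : Set} → A × B × Bool → Bool
halted (_ , _ , h) = h

-- Block nodes are identified by (label, version): the version counts how many
-- times a node with this label has been replaced.
-- A/C blocks (addresses j < K, K = number of blocks of A and C) get label j;
-- other blocks get fresh labels K, K+1, ... in order of first access.
-- The graph is the list of its edges, in order of creation (the node set is
-- the fixed initial nodes together with the endpoints of edges).

data Node : Set where
  blockNode : (label version : ℕ) → Node
  memNode   : ℕ → Node

Edge : Set
Edge = Node × Node

record GState : Set where
  constructor gstate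
  field
    labelOf : ℕ → Maybe ℕ
    version : ℕ → ℕ         -- label ↦ version of its live node
    fresh   : ℕ
    curMem  : ℕ
    since   : ℕ             -- I/Os since the live memory node was created

initGState : ℕ → GState
initGState K = gstate (λ j → if j <ᵇ K then just j else nothing) (λ _ → 0) K 0 0

-- the memory-node switch performed after each I/O (every q = m/b I/Os)
memSwitch : ℕ → GState → GState × List Edge
memSwitch q (gstate L V f c s) =
  if suc s ≡ᵇ q
  then (gstate L V f (suc c) 0 , (memNode c , memNode (suc c)) ∷ [])
  else (gstate L V f c (suc s) , [])

ioStep : ℕ → GState → ℕ → GState × List Edge
ioStep q (gstate L V f c s) j with L j
... | nothing with memSwitch q (gstate (λ a → if a ≡ᵇ j then just f else L a) V (suc f) c s)
...   | st , es = st , ((memNode c , blockNode f (V f)) ∷ es)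
ioStep q (gstate L V f c s) j | just lab
  with memSwitch q (gstate L (λ l → if l ≡ᵇ lab then suc (V l) else V l) f c s)
...   | st , es = st , ((blockNode lab (V lab) , memNode c) ∷ (memNode c , blockNode lab (suc (V lab))) ∷ es)

ioEdges : ℕ → GState → List ℕ → List Edge
ioEdges q st []       = []
ioEdges q st (j ∷ js) with ioStep q st j
... | st' , es = es ++ˡ ioEdges q st' js

-- the I/O-graph of a sequence of accessed block addresses,
-- with K initial (A and C) blocks and memory of m/b blocks
IOGraph : Set
IOGraph = List Edge

ioGraph : (K q : ℕ) → List ℕ → IOGraph
ioGraph K q = ioEdges q (initGState K)

-- An I/O-graph does not depend on the block addresses that are accessed, only on the labels
-- they receive: replaying the label sequence as an access sequence yields the same graph, since
-- then every block is its own label. The i-th label is one of the K = n(w+lg n)/b + nw/b initial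
-- labels or one of at most t fresh ones, and an execution makes at most t I/Os, so every
-- I/O-graph is the graph of one of the at most (K+t+1)^t sequences of length ≤ t over [0, K+t).
module Submission where

open import Defs
open import Data.Bool using (Bool; true; false; if_then_else_)
open import Data.Nat using (ℕ; zero; suc; _+_; _*_; _/_; _^_; _≤_; _<_; _≡ᵇ_; _<ᵇ_; z≤n; s≤s; z<s; NonZero)
open import Data.Nat.Properties
open import Data.Nat.Divisibility using (_∣_)
open import Data.Fin using (Fin; toℕ)
open import Data.Fin.Permutation using (Permutation′; _⟨$⟩ʳ_)
open import Data.Vec using (Vec; lookup)
open import Data.List using (List; []; _∷_; [_]; length; map; upTo; cartesianProductWith)
  renaming (_++_ to _++ˡ_)
open import Data.List.Properties using (length-++; length-map; length-upTo)
open import Data.List.Membership.Propositional using (_∈_)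
open import Data.List.Membership.Propositional.Properties using (∈-map⁺; ∈-upTo⁺; ∈-cartesianProductWith⁺)
open import Data.List.Relation.Unary.All as All using (All; []; _∷_)
open import Data.List.Relation.Unary.Any using (here; there)
open import Data.Maybe using (just; nothing; fromMaybe)
open import Data.Product using (_×_; _,_; proj₁; proj₂; ∃)
open import Relation.Nullary using (contradiction)
open import Relation.Nullary.Reflects using (Reflects; ofʸ; ofⁿ; fromEquivalence)
open import Relation.Binary.PropositionalEquality
  using (_≡_; refl; sym; trans; cong; cong₂; subst)

length-cartesianProductWith : ∀ {A B C : Set} (f : A → B → C) (xs : List A) (ys : List B)
  → length (cartesianProductWith f xs ys) ≡ length xs * length ys
length-cartesianProductWith f []       ys = refl
length-cartesianProductWith f (x ∷ xs) ys = begin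
  length (map (f x) ys ++ˡ cartesianProductWith f xs ys)
    ≡⟨ length-++ (map (f x) ys) ⟩
  length (map (f x) ys) + length (cartesianProductWith f xs ys)
    ≡⟨ cong₂ _+_ (length-map (f x) ys) (length-cartesianProductWith f xs ys) ⟩
  length ys + length xs * length ys
    ∎
  where open Relation.Binary.PropositionalEquality.≡-Reasoning

boundedLists : ℕ → ℕ → List (List ℕ)
boundedLists N zero    = [ [] ]
boundedLists N (suc t) = [] ∷ cartesianProductWith _∷_ (upTo N) (boundedLists N t)

∈-boundedLists : ∀ N t (xs : List ℕ) → length xs ≤ t → All (_< N) xs → xs ∈ boundedLists N t
∈-boundedLists N zero    []       _         _          = here refl
∈-boundedLists N (suc t) []       _         _          = here refl
∈-boundedLists N (suc t) (x ∷ xs) (s≤s length≤t) (x<N ∷ xs<N) =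
  there (∈-cartesianProductWith⁺ _∷_ (∈-upTo⁺ x<N) (∈-boundedLists N t xs length≤t xs<N))

length-boundedLists : ∀ N t → length (boundedLists N t) ≤ suc N ^ t
length-boundedLists N zero    = ≤-refl
length-boundedLists N (suc t) = begin
  suc (length (cartesianProductWith _∷_ (upTo N) (boundedLists N t)))
    ≡⟨ cong suc (length-cartesianProductWith _∷_ (upTo N) (boundedLists N t)) ⟩
  suc (length (upTo N) * length (boundedLists N t))
    ≡⟨ cong (λ k → suc (k * length (boundedLists N t))) (length-upTo N) ⟩
  suc (N * length (boundedLists N t))
    ≤⟨ s≤s (*-monoʳ-≤ N (length-boundedLists N t)) ⟩
  1 + N * suc N ^ t
    ≤⟨ +-monoˡ-≤ (N * suc N ^ t) (m^n>0 (suc N) t) ⟩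
  suc N ^ t + N * suc N ^ t
    ∎
  where open ≤-Reasoning

length-accesses-exec : ∀ {m b} (𝒜 : Algorithm m b) fuel M D → length (accesses (exec 𝒜 fuel M D)) ≤ fuel
length-accesses-exec 𝒜 fuel M D with 𝒜 M
... | halt = z≤n
length-accesses-exec 𝒜 zero    M D | read j f = z≤n
length-accesses-exec {b = b} 𝒜 (suc k) M D | read j f =
  s≤s (length-accesses-exec 𝒜 k (f (readBlock b D j)) D)
length-accesses-exec 𝒜 zero    M D | write j x M′ = z≤n
length-accesses-exec {b = b} 𝒜 (suc k) M D | write j x M′ =
  s≤s (length-accesses-exec 𝒜 k M′ (writeBlock b D j x))

label : GState → ℕ → ℕ
label st j = fromMaybe (GState.fresh st) (GState.labelOf st j)

labels : ℕ → GState → List ℕ → List ℕ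
labels q st []       = []
labels q st (j ∷ js) = label st j ∷ labels q (proj₁ (ioStep q st j)) js

length-labels : ∀ q st js → length (labels q st js) ≡ length js
length-labels q st []       = refl
length-labels q st (j ∷ js) = cong suc (length-labels q (proj₁ (ioStep q st j)) js)

-- st′ is the state reached by accessing labels instead of addresses: there each of the labels
-- 0, …, f − 1 in use is its own address.
data Relabelled : GState → GState → Set where
  relabelled : ∀ {L L′ V f c s}
    → (∀ a l → L a ≡ just l → l < f)
    → (∀ x → x < f → L′ x ≡ just x)
    → (∀ x → f ≤ x → L′ x ≡ nothing)
    → Relabelled (gstate L V f c s) (gstate L′ V f c s)

≡ᵇ-reflects-≡ : ∀ m n → Reflects (m ≡ n) (m ≡ᵇ n)
≡ᵇ-reflects-≡ m n = fromEquivalence (≡ᵇ⇒≡ m n) (≡⇒≡ᵇ m n)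

Relabelled-initGState : ∀ K → Relabelled (initGState K) (initGState K)
Relabelled-initGState K = relabelled below known unknown
  where
    below : ∀ a l → (if a <ᵇ K then just a else nothing) ≡ just l → l < K
    below a l eq with a <ᵇ K | <ᵇ-reflects-< a K
    below a .a refl | true | ofʸ a<K = a<K

    known : ∀ x → x < K → (if x <ᵇ K then just x else nothing) ≡ just x
    known x x<K with x <ᵇ K | <ᵇ-reflects-< x K
    ... | true  | _        = refl
    ... | false | ofⁿ x≮K = contradiction x<K x≮K

    unknown : ∀ x → K ≤ x → (if x <ᵇ K then just x else nothing) ≡ nothing
    unknown x K≤x with x <ᵇ K | <ᵇ-reflects-< x K
    ... | true  | ofʸ x<K = contradiction x<K (≤⇒≯ K≤x)
    ... | false | _       = refl

Relabelled-fresh : ∀ {L L′ V f c s} j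
  → Relabelled (gstate L V f c s) (gstate L′ V f c s)
  → Relabelled (gstate (λ a → if a ≡ᵇ j then just f else L a) V (suc f) c s)
               (gstate (λ a → if a ≡ᵇ f then just f else L′ a) V (suc f) c s)
Relabelled-fresh {L} {L′} {f = f} j (relabelled below known unknown) =
  relabelled below′ known′ unknown′
  where
    below′ : ∀ a l → (if a ≡ᵇ j then just f else L a) ≡ just l → l < suc f
    below′ a l eq with a ≡ᵇ j
    below′ a .f refl | true  = ≤-refl
    ...              | false = m<n⇒m<1+n (below a l eq)

    known′ : ∀ x → x < suc f → (if x ≡ᵇ f then just f else L′ x) ≡ just x
    known′ x x<1+f with x ≡ᵇ f | ≡ᵇ-reflects-≡ x f
    ... | true  | ofʸ refl = refl
    ... | false | ofⁿ x≢f = known x (≤∧≢⇒< (≤-pred x<1+f) x≢f)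

    unknown′ : ∀ x → suc f ≤ x → (if x ≡ᵇ f then just f else L′ x) ≡ nothing
    unknown′ x f<x with x ≡ᵇ f | ≡ᵇ-reflects-≡ x f
    ... | true  | ofʸ refl = contradiction f<x (<-irrefl refl)
    ... | false | _        = unknown x (<⇒≤ f<x)

memSwitch-Relabelled : ∀ q {st st′} → Relabelled st st′
  → proj₂ (memSwitch q st) ≡ proj₂ (memSwitch q st′)
  × Relabelled (proj₁ (memSwitch q st)) (proj₁ (memSwitch q st′))
memSwitch-Relabelled q (relabelled {s = s} below known unknown) with suc s ≡ᵇ q
... | true  = refl , relabelled below known unknown
... | false = refl , relabelled below known unknown

ioStep-Relabelled : ∀ q j {st st′} → Relabelled st st′
  → proj₂ (ioStep q st j) ≡ proj₂ (ioStep q st′ (label st j))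
  × Relabelled (proj₁ (ioStep q st j)) (proj₁ (ioStep q st′ (label st j)))
ioStep-Relabelled q j r@(relabelled {L} {f = f} below known unknown) with L j in eq
... | nothing rewrite unknown f ≤-refl =
  let edges≡ , r′ = memSwitch-Relabelled q (Relabelled-fresh j r)
  in cong (_ ∷_) edges≡ , r′
... | just l rewrite known l (below j l eq) =
  let edges≡ , r′ = memSwitch-Relabelled q (relabelled below known unknown)
  in cong (λ es → _ ∷ _ ∷ es) edges≡ , r′

ioEdges-Relabelled : ∀ q js {st st′} → Relabelled st st′
  → ioEdges q st js ≡ ioEdges q st′ (labels q st js)
ioEdges-Relabelled q []       r = refl
ioEdges-Relabelled q (j ∷ js) r =
  let edges≡ , r′ = ioStep-Relabelled q j r
  in cong₂ _++ˡ_ edges≡ (ioEdges-Relabelled q js r′)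

fresh-memSwitch : ∀ q st → GState.fresh (proj₁ (memSwitch q st)) ≡ GState.fresh st
fresh-memSwitch q (gstate L V f c s) with suc s ≡ᵇ q
... | true  = refl
... | false = refl

fresh-ioStep : ∀ q st j → GState.fresh (proj₁ (ioStep q st j)) ≤ suc (GState.fresh st)
fresh-ioStep q (gstate L V f c s) j with L j
... | nothing = ≤-reflexive (fresh-memSwitch q (gstate _ V (suc f) c s))
... | just l  = ≤-trans (≤-reflexive (fresh-memSwitch q (gstate L _ f c s))) (n≤1+n f)

label-≤-fresh : ∀ j {st st′} → Relabelled st st′ → label st j ≤ GState.fresh st
label-≤-fresh j (relabelled {L} below _ _) with L j in eq
... | nothing = ≤-refl
... | just l  = <⇒≤ (below j l eq)

labels-< : ∀ q js {st st′} → Relabelled st st′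
  → All (_< GState.fresh st + length js) (labels q st js)
labels-< q []       r = []
labels-< q (j ∷ js) {st} r =
  ≤-trans (s≤s (label-≤-fresh j r)) (m<m+n _ z<s)
  ∷ All.map (λ l< → ≤-trans l< fresh-bound) (labels-< q js (proj₂ (ioStep-Relabelled q j r)))
  where
    fresh-bound : GState.fresh (proj₁ (ioStep q st j)) + length js ≤ GState.fresh st + suc (length js)
    fresh-bound = ≤-trans (+-monoˡ-≤ (length js) (fresh-ioStep q st j))
                          (≤-reflexive (sym (+-suc _ (length js))))

lemma2 : (n w b m t : ℕ) .{{_ : NonZero b}}
    → lg n ≤ w → (w + lg n) ∣ b → w ∣ b → b ∣ n * (w + lg n) → b ∣ n * w → b ≤ m
    → (𝒜 : Algorithm m b)
    → (∀ (π : Permutation′ n) (d : Fin n → Vec Bool w) → halted (run n w 𝒜 t π d) ≡ true)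
    → (∀ (π : Permutation′ n) (d : Fin n → Vec Bool w) (i : Fin n) (r : Fin w)
         → finalDisk (run n w 𝒜 t π d) (n * (lg n + w) + toℕ (π ⟨$⟩ʳ i) * w + toℕ r) ≡ lookup (d i) r)
    → ∃ λ (Gs : List IOGraph) → ((length Gs ≤ (t + n * (w + lg n) / b + n * w / b + 1) ^ (t + 1))
               × (∀ (π : Permutation′ n) (d : Fin n → Vec Bool w)
                    → ioGraph (n * (w + lg n) / b + n * w / b) (m / b) (accesses (run n w 𝒜 t π d)) ∈ Gs))
lemma2 n w b m t _ _ _ _ _ _ 𝒜 _ _ = map (ioGraph K q) (boundedLists N t) , count , covers
  where
    K N q : ℕ
    K = n * (w + lg n) / b + n * w / b
    N = t + n * (w + lg n) / b + n * w / b
    q = m / b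

    K+t≡N : K + t ≡ N
    K+t≡N = trans (+-comm K t) (sym (+-assoc t (n * (w + lg n) / b) (n * w / b)))

    count : length (map (ioGraph K q) (boundedLists N t)) ≤ (N + 1) ^ (t + 1)
    count = begin
      length (map (ioGraph K q) (boundedLists N t)) ≡⟨ length-map (ioGraph K q) (boundedLists N t) ⟩
      length (boundedLists N t)                     ≤⟨ length-boundedLists N t ⟩
      suc N ^ t                                     ≤⟨ ^-monoʳ-≤ (suc N) (m≤m+n t 1) ⟩
      suc N ^ (t + 1)                               ≡⟨ cong (_^ (t + 1)) (+-comm 1 N) ⟩
      (N + 1) ^ (t + 1)                             ∎
      where open ≤-Reasoning

    covers : ∀ π d → ioGraph K q (accesses (run n w 𝒜 t π d)) ∈ map (ioGraph K q) (boundedLists N t)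
    covers π d = subst (_∈ _) (sym (ioEdges-Relabelled q js init))
      (∈-map⁺ (ioGraph K q) (∈-boundedLists N t (labels q (initGState K) js) length≤t labels<N))
      where
        js : List ℕ
        js = accesses (run n w 𝒜 t π d)

        init : Relabelled (initGState K) (initGState K)
        init = Relabelled-initGState K

        length-js≤t : length js ≤ t
        length-js≤t = length-accesses-exec 𝒜 t _ _

        length≤t : length (labels q (initGState K) js) ≤ t
        length≤t = ≤-trans (≤-reflexive (length-labels q (initGState K) js)) length-js≤t

        labels<N : All (_< N) (labels q (initGState K) js)
        labels<N = All.map (λ l< → ≤-trans l< (≤-trans (+-monoʳ-≤ K length-js≤t) (≤-reflexive K+t≡N)))
                           (labels-< q js init)
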